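{- For all integers $n,i,k\ge 0$, \[ \binom{n}{i}\binom{n+i}{i}\binom{n}{k}\binom{n+k}{k}=\sum_{j\ge 0}\binom{i+k}{i}\binom{j}{j-i,\;j-k,\;i+k-j}\binom{n}{j}\binom{n+j}{j}. \]
   Context: For integers $m,a,b,c$, the multinomial coefficient $\binom{m}{a,b,c}$ equals $\frac{m!}{a!\,b!\,c!}$ if $a,b,c\ge 0$ and $a+b+c=m$, and $0$ otherwise. Binomial coefficients $\binom{N}{K}$ with $K<0$ or $K>N$ (for $N\ge 0$) are $0$. -}

module Defs where

open import Data.Nat using (ℕ; zero; suc; _+_; _*_; _/_; _≟_; _!)
open import Data.Nat.Properties using (_!≢0; m*n≢0)
open import Data.Integer using (ℤ; +_; -[1+_])
open import Relation.Nullary.Decidable using (does)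
open import Data.Bool using (if_then_else_)

sumTo : ℕ → (ℕ → ℕ) → ℕ
sumTo zero    f = 0
sumTo (suc n) f = sumTo n f + f n

multinomial : ℕ → ℤ → ℤ → ℤ → ℕ
multinomial m (+ a) (+ b) (+ c) =
  if does (a + b + c ≟ m)
  then (m ! / (a ! * b ! * c !)) {{m*n≢0 (a ! * b !) (c !) {{m*n≢0 (a !) (b !) {{a !≢0}} {{b !≢0}}}} {{c !≢0}}}}
  else 0
multinomial m _ _ _ = 0

module Submission where

-- Write F n j = C(n,j)·C(n+j,j).  In j these numbers satisfy the three-term
-- recurrence  (j+1)²·F n (j+1) + j(j+1)·F n j = n(n+1)·F n j,  and a solution
-- of it is determined by its value at j = 0.  So the left-hand side
-- F n i · F n k, as a sequence in k, is fixed by this recurrence and by its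
-- value F n i at k = 0.
--
-- On the right-hand side only j = k + a with 0 ≤ a ≤ i contributes, where the
-- multinomial equals C(k+a,i)·C(i,a); the sum becomes
--     S n i k = Σ_{a ≤ i} C(i+k,i)·C(k+a,i)·C(i,a) · F n (k+a).
-- Expanding n(n+1)·F n (k+a) by the recurrence and re-collecting terms shows
-- that S n i satisfies the same recurrence in k, given a pointwise binomial
-- identity between its coefficients (coeff-recurrence).  With S n i 0 = F n i,
-- uniqueness proves the theorem.

open import Defs
open import Data.Nat using (ℕ; zero; suc; _+_; _*_; _∸_; _≤_; _<_; s≤s; _!; _≟_; NonZero)
open import Data.Nat.Properties
open import Data.Nat.Combinatorics using (_C_; nCk+nC[k+1]≡[n+1]C[k+1]; nCk≡n!/k![n-k]!; k![n∸k]!∣n!; k>n⇒nCk≡0; nCn≡1)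
open import Data.Nat.DivMod using (_/_; m/n*n≡m; m*n/n≡m; /-congˡ)
open import Data.Nat.Tactic.RingSolver using (solve; solve-∀)
open import Data.List using (_∷_; [])
import Algebra.Properties.CommutativeSemigroup as CommutativeSemigroupProperties
open import Data.Integer using (+_; -[1+_]; _-_; _⊖_; -_)
open import Data.Integer.Properties using ([+m]-[+n]≡m⊖n; ⊖-≥; ⊖-<)
open import Relation.Binary.PropositionalEquality using (_≡_; refl; sym; trans; cong; cong₂; module ≡-Reasoning)
open import Relation.Nullary using (yes; no)
open import Relation.Nullary.Decidable using (dec-true)

open ≡-Reasoning
open CommutativeSemigroupProperties +-commutativeSemigroup using () renaming (interchange to +-interchange; xy∙z≈xz∙y to +-right-comm)
open CommutativeSemigroupProperties *-commutativeSemigroup using () renaming (x∙yz≈y∙xz to *-left-comm)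

C-factorial : ∀ {n k} → k ≤ n → (n C k) * (k ! * (n ∸ k) !) ≡ n !
C-factorial {n} {k} k≤n = begin
  (n C k) * (k ! * (n ∸ k) !)                 ≡⟨ cong (_* (k ! * (n ∸ k) !)) (nCk≡n!/k![n-k]! k≤n) ⟩
  n ! / (k ! * (n ∸ k) !) * (k ! * (n ∸ k) !) ≡⟨ m/n*n≡m (k![n∸k]!∣n! k≤n) ⟩
  n !                                         ∎
  where instance _ = k !* (n ∸ k) !≢0

-- Absorption: (k+1)·C(n+1,k+1) = (n+1)·C(n,k).  Both sides times k!(n−k)!
-- equal (n+1)!, and for k > n both sides vanish.
C-absorption : ∀ n k → suc k * (suc n C suc k) ≡ suc n * (n C k)
C-absorption n k with k ≤? n
... | yes k≤n = *-cancelʳ-≡ _ _ (k ! * (n ∸ k) !) (begin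
  suc k * (suc n C suc k) * (k ! * (n ∸ k) !) ≡⟨ regroup (suc k) (suc n C suc k) (k !) ((n ∸ k) !) ⟩
  (suc n C suc k) * (suc k * k ! * (n ∸ k) !) ≡⟨ C-factorial (s≤s k≤n) ⟩
  suc n * n !                                 ≡⟨ cong (suc n *_) (sym (C-factorial k≤n)) ⟩
  suc n * ((n C k) * (k ! * (n ∸ k) !))       ≡⟨ sym (*-assoc (suc n) (n C k) _) ⟩
  suc n * (n C k) * (k ! * (n ∸ k) !)         ∎)
  where
    instance _ = k !* (n ∸ k) !≢0
    regroup : ∀ s c f g → s * c * (f * g) ≡ c * (s * f * g)
    regroup = solve-∀
... | no k≰n = begin
  suc k * (suc n C suc k) ≡⟨ cong (suc k *_) (k>n⇒nCk≡0 (s≤s (≰⇒> k≰n))) ⟩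
  suc k * 0               ≡⟨ *-zeroʳ (suc k) ⟩
  0                       ≡⟨ sym (*-zeroʳ (suc n)) ⟩
  suc n * 0               ≡⟨ cong (suc n *_) (sym (k>n⇒nCk≡0 (≰⇒> k≰n))) ⟩
  suc n * (n C k)         ∎

-- Moving down a column: (n+1−j)·C(n+1,j) = (n+1)·C(n,j), written without
-- subtraction so that it also holds for j > n+1.
C-row : ∀ n j → suc n * (n C j) + j * (suc n C j) ≡ suc n * (suc n C j)
C-row n zero    = +-identityʳ (suc n * 1)
C-row n (suc j) = begin
  suc n * (n C suc j) + suc j * (suc n C suc j) ≡⟨ cong (λ z → suc n * (n C suc j) + z) (C-absorption n j) ⟩
  suc n * (n C suc j) + suc n * (n C j)         ≡⟨ sym (*-distribˡ-+ (suc n) (n C suc j) (n C j)) ⟩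
  suc n * ((n C suc j) + (n C j))               ≡⟨ cong (suc n *_) (+-comm (n C suc j) (n C j)) ⟩
  suc n * ((n C j) + (n C suc j))               ≡⟨ cong (suc n *_) (nCk+nC[k+1]≡[n+1]C[k+1] n j) ⟩
  suc n * (suc n C suc j)                       ∎

-- Moving along a row: (a+1)·C(n,a+1) = (n−a)·C(n,a), without subtraction.
C-column : ∀ n a → suc a * (n C suc a) + a * (n C a) ≡ n * (n C a)
C-column zero    zero    = refl
C-column zero    (suc a) = cong₂ _+_ (*-zeroʳ (suc (suc a))) (*-zeroʳ (suc a))
C-column (suc n) a       = trans (cong (_+ a * (suc n C a)) (C-absorption n a)) (C-row n a)

C-row-complement : ∀ j m → suc m * (suc (j + m) C j) ≡ suc (j + m) * ((j + m) C j)
C-row-complement j m = +-cancelʳ-≡ (j * c′) _ _ (begin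
  suc m * c′ + j * c′      ≡⟨ sym (*-distribʳ-+ c′ (suc m) j) ⟩
  (suc m + j) * c′         ≡⟨ cong (_* c′) (+-comm (suc m) j) ⟩
  (j + suc m) * c′         ≡⟨ cong (_* c′) (+-suc j m) ⟩
  suc (j + m) * c′         ≡⟨ sym (C-row (j + m) j) ⟩
  suc (j + m) * c + j * c′ ∎)
  where
    c  = (j + m) C j
    c′ = suc (j + m) C j

F : ℕ → ℕ → ℕ
F n j = (n C j) * ((n + j) C j)

ThreeTerm : ℕ → (ℕ → ℕ) → Set
ThreeTerm c x = ∀ k → suc k * suc k * x (suc k) + k * suc k * x k ≡ c * x k

-- Solutions of the recurrence are determined by their initial value, since the
-- leading coefficient (k+1)² never vanishes.
three-term-unique : ∀ {c} {x y : ℕ → ℕ} → ThreeTerm c x → ThreeTerm c y →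
                    x 0 ≡ y 0 → ∀ k → x k ≡ y k
three-term-unique rx ry x0≡y0 zero = x0≡y0
three-term-unique {c} {x} {y} rx ry x0≡y0 (suc k) =
  *-cancelˡ-≡ _ _ (suc k * suc k) (+-cancelʳ-≡ (k * suc k * y k) _ _ (begin
    suc k * suc k * x (suc k) + k * suc k * y k ≡⟨ cong (λ t → suc k * suc k * x (suc k) + k * suc k * t) (sym IH) ⟩
    suc k * suc k * x (suc k) + k * suc k * x k ≡⟨ rx k ⟩
    c * x k                                     ≡⟨ cong (c *_) IH ⟩
    c * y k                                     ≡⟨ sym (ry k) ⟩
    suc k * suc k * y (suc k) + k * suc k * y k ∎))
  where IH = three-term-unique {c} rx ry x0≡y0 k

three-term-scale : ∀ {c} {x : ℕ → ℕ} m → ThreeTerm c x → ThreeTerm c (λ k → m * x k)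
three-term-scale {c} {x} m rx k = begin
  suc k * suc k * (m * x (suc k)) + k * suc k * (m * x k) ≡⟨ factor-out k m (x (suc k)) (x k) ⟩
  m * (suc k * suc k * x (suc k) + k * suc k * x k)       ≡⟨ cong (m *_) (rx k) ⟩
  m * (c * x k)                                           ≡⟨ *-left-comm m c (x k) ⟩
  c * (m * x k)                                           ∎
  where
    factor-out : ∀ k m x₁ x₀ → suc k * suc k * (m * x₁) + k * suc k * (m * x₀)
                               ≡ m * (suc k * suc k * x₁ + k * suc k * x₀)
    factor-out = solve-∀

-- The arithmetic behind F-recurrence: if X/b = (n−j)/(j+1) and
-- Y/b′ = (n+j+1)/(j+1), then (j+1)²·XY + j(j+1)·bb′ = n(n+1)·bb′.
three-term-from-ratios : ∀ n j b b′ X Y →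
  suc j * X + j * b ≡ n * b → suc j * Y ≡ suc (n + j) * b′ →
  suc j * suc j * (X * Y) + j * suc j * (b * b′) ≡ n * suc n * (b * b′)
three-term-from-ratios n j b b′ X Y hX hY = +-cancelʳ-≡ (n * j * (b * b′)) _ _ (begin
  suc j * suc j * (X * Y) + j * suc j * (b * b′) + n * j * (b * b′)
    ≡⟨ solve (n ∷ j ∷ b ∷ b′ ∷ X ∷ Y ∷ []) ⟩
  suc j * X * (suc j * Y) + j * b * (suc (n + j) * b′)
    ≡⟨ cong (λ t → suc j * X * t + j * b * (suc (n + j) * b′)) hY ⟩
  suc j * X * (suc (n + j) * b′) + j * b * (suc (n + j) * b′)
    ≡⟨ sym (*-distribʳ-+ (suc (n + j) * b′) (suc j * X) (j * b)) ⟩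
  (suc j * X + j * b) * (suc (n + j) * b′)
    ≡⟨ cong (_* (suc (n + j) * b′)) hX ⟩
  n * b * (suc (n + j) * b′)
    ≡⟨ solve (n ∷ j ∷ b ∷ b′ ∷ []) ⟩
  n * suc n * (b * b′) + n * j * (b * b′) ∎)

F-recurrence : ∀ n → ThreeTerm (n * suc n) (F n)
F-recurrence n j rewrite +-suc n j =
  three-term-from-ratios n j (n C j) ((n + j) C j) (n C suc j) (suc (n + j) C suc j)
    (C-column n j) (C-absorption (n + j) j)

sum-cong : ∀ m {f g : ℕ → ℕ} → (∀ j → j < m → f j ≡ g j) → sumTo m f ≡ sumTo m g
sum-cong zero    f≡g = refl
sum-cong (suc m) f≡g = cong₂ _+_ (sum-cong m (λ j j<m → f≡g j (m<n⇒m<1+n j<m))) (f≡g m ≤-refl)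

sum-+ : ∀ m (f g : ℕ → ℕ) → sumTo m (λ j → f j + g j) ≡ sumTo m f + sumTo m g
sum-+ zero    f g = refl
sum-+ (suc m) f g = begin
  sumTo m (λ j → f j + g j) + (f m + g m) ≡⟨ cong (_+ (f m + g m)) (sum-+ m f g) ⟩
  sumTo m f + sumTo m g + (f m + g m)     ≡⟨ +-interchange (sumTo m f) (sumTo m g) (f m) (g m) ⟩
  sumTo m f + f m + (sumTo m g + g m)     ∎

sum-* : ∀ m c (f : ℕ → ℕ) → sumTo m (λ j → c * f j) ≡ c * sumTo m f
sum-* zero    c f = sym (*-zeroʳ c)
sum-* (suc m) c f = trans (cong (_+ c * f m) (sum-* m c f)) (sym (*-distribˡ-+ c (sumTo m f) (f m)))

sum-vanishing : ∀ m (f : ℕ → ℕ) → (∀ j → j < m → f j ≡ 0) → sumTo m f ≡ 0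
sum-vanishing zero    f f≡0 = refl
sum-vanishing (suc m) f f≡0 = cong₂ _+_ (sum-vanishing m f (λ j j<m → f≡0 j (m<n⇒m<1+n j<m))) (f≡0 m ≤-refl)

sum-drop-prefix : ∀ m l (f : ℕ → ℕ) → (∀ j → j < m → f j ≡ 0) →
                  sumTo (m + l) f ≡ sumTo l (λ a → f (m + a))
sum-drop-prefix m zero    f f≡0 = trans (cong (λ t → sumTo t f) (+-identityʳ m)) (sum-vanishing m f f≡0)
sum-drop-prefix m (suc l) f f≡0 = begin
  sumTo (m + suc l) f         ≡⟨ cong (λ t → sumTo t f) (+-suc m l) ⟩
  sumTo (m + l) f + f (m + l) ≡⟨ cong (_+ f (m + l)) (sum-drop-prefix m l f f≡0) ⟩
  sumTo l (λ a → f (m + a)) + f (m + l) ∎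

sum-shift-vanishing : ∀ m (h : ℕ → ℕ) → h 0 ≡ 0 → h (suc m) ≡ 0 →
                      sumTo (suc m) h ≡ sumTo (suc m) (λ a → h (suc a))
sum-shift-vanishing m h h0 hm = begin
  sumTo (suc m) h                  ≡⟨ first-out m ⟩
  h 0 + sumTo m (λ a → h (suc a))  ≡⟨ cong₂ _+_ h0 (sym (+-identityʳ _)) ⟩
  sumTo m (λ a → h (suc a)) + 0    ≡⟨ cong (λ z → sumTo m (λ a → h (suc a)) + z) (sym hm) ⟩
  sumTo (suc m) (λ a → h (suc a))  ∎
  where
    first-out : ∀ m → sumTo (suc m) h ≡ h 0 + sumTo m (λ a → h (suc a))
    first-out zero    = sym (+-identityʳ (h 0))
    first-out (suc m) = trans (cong (_+ h (suc m)) (first-out m)) (+-assoc (h 0) _ _)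

coeff : ℕ → ℕ → ℕ → ℕ
coeff i k a = ((i + k) C i) * ((k + a) C i) * (i C a)

-- The right-hand side of the theorem, re-indexed by j = k + a.
S : ℕ → ℕ → ℕ → ℕ
S n i k = sumTo (suc i) (λ a → coeff i k a * F n (k + a))

-- The arithmetic behind coeff-recurrence, in terms of
-- p = C(i+k,i), p′ = C(i+k+1,i), u = C(k+a,i), q = C(k+a+1,i), r = C(i,a),
-- s = C(i,a+1) and the three binomial relations linking them.
coeff-arith : ∀ k a i p p′ u q r s →
  suc k * p′ ≡ suc (i + k) * p →
  suc (k + a) * u + i * q ≡ suc (k + a) * q →
  suc a * s + a * r ≡ i * r →
  suc k * suc k * (p′ * q * r)
    ≡ suc (k + a) * suc (k + a) * (p * u * r) + suc a * (suc k + k + suc a) * (p * q * s)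
coeff-arith k a i p p′ u q r s hp hq hs = +-cancelʳ-≡ Z _ _ (begin
  suc k * suc k * (p′ * q * r) + Z
    ≡⟨ cong (_+ Z) (square-out k p′ q r) ⟩
  suc k * q * r * (suc k * p′) + Z
    ≡⟨ cong (λ t → suc k * q * r * t + Z) hp ⟩
  suc k * q * r * (suc (i + k) * p) + Z
    ≡⟨ collect k a i p q r ⟩
  N * p * r * (N * q) + M * p * q * (i * r)
    ≡⟨ cong₂ (λ t t′ → N * p * r * t + M * p * q * t′) (sym hq) (sym hs) ⟩
  N * p * r * (N * u + i * q) + M * p * q * (suc a * s + a * r)
    ≡⟨ expand k a i p u q r s ⟩
  N * N * (p * u * r) + suc a * M * (p * q * s) + Z ∎)
  where
    N = suc (k + a)
    M = suc k + k + suc a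
    Z = N * p * r * (i * q) + M * p * q * (a * r)
    square-out : ∀ k x q r → suc k * suc k * (x * q * r) ≡ suc k * q * r * (suc k * x)
    square-out = solve-∀
    -- (k+1)(i+k+1) + (k+a+1)i + (2k+a+2)a = (k+a+1)² + (2k+a+2)i
    collect : ∀ k a i p q r →
      suc k * q * r * (suc (i + k) * p)
        + (suc (k + a) * p * r * (i * q) + (suc k + k + suc a) * p * q * (a * r))
        ≡ suc (k + a) * p * r * (suc (k + a) * q) + (suc k + k + suc a) * p * q * (i * r)
    collect = solve-∀
    expand : ∀ k a i p u q r s →
      suc (k + a) * p * r * (suc (k + a) * u + i * q) + (suc k + k + suc a) * p * q * (suc a * s + a * r)
        ≡ suc (k + a) * suc (k + a) * (p * u * r) + suc a * (suc k + k + suc a) * (p * q * s)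
          + (suc (k + a) * p * r * (i * q) + (suc k + k + suc a) * p * q * (a * r))
    expand = solve-∀

coeff-recurrence : ∀ i k a →
  suc k * suc k * coeff i (suc k) a
    ≡ suc (k + a) * suc (k + a) * coeff i k a + suc a * (suc k + k + suc a) * coeff i k (suc a)
coeff-recurrence i k a rewrite +-suc i k | +-suc k a =
  coeff-arith k a i ((i + k) C i) (suc (i + k) C i) ((k + a) C i) (suc (k + a) C i) (i C a) (i C suc a)
    (C-row-complement i k) (C-row (k + a) i) (C-column i a)

S-recurrence : ∀ n i → ThreeTerm (n * suc n) (S n i)
S-recurrence n i k = begin
  suc k * suc k * S n i (suc k) + K * S n i k
    ≡⟨ cong (_+ K * S n i k) (sym (sum-* (suc i) (suc k * suc k) g′)) ⟩
  sumTo (suc i) (λ a → suc k * suc k * g′ a) + K * S n i k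
    ≡⟨ cong (_+ K * S n i k) (sum-cong (suc i) (λ a _ → next-term a)) ⟩
  sumTo (suc i) (λ a → t a + h (suc a)) + K * S n i k
    ≡⟨ cong (_+ K * S n i k) (sum-+ (suc i) t (λ a → h (suc a))) ⟩
  sumTo (suc i) t + sumTo (suc i) (λ a → h (suc a)) + K * S n i k
    ≡⟨ cong (λ z → sumTo (suc i) t + z + K * S n i k) (sym (sum-shift-vanishing i h refl h-last)) ⟩
  sumTo (suc i) t + sumTo (suc i) h + K * S n i k
    ≡⟨ +-right-comm (sumTo (suc i) t) (sumTo (suc i) h) (K * S n i k) ⟩
  sumTo (suc i) t + K * S n i k + sumTo (suc i) h
    ≡⟨ cong (λ z → sumTo (suc i) t + z + sumTo (suc i) h) (sym (sum-* (suc i) K g)) ⟩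
  sumTo (suc i) t + sumTo (suc i) (λ a → K * g a) + sumTo (suc i) h
    ≡⟨ cong (_+ sumTo (suc i) h) (sym (sum-+ (suc i) t (λ a → K * g a))) ⟩
  sumTo (suc i) (λ a → t a + K * g a) + sumTo (suc i) h
    ≡⟨ sym (sum-+ (suc i) (λ a → t a + K * g a) h) ⟩
  sumTo (suc i) (λ a → t a + K * g a + h a)
    ≡⟨ sum-cong (suc i) (λ a _ → sym (this-term a)) ⟩
  sumTo (suc i) (λ a → n * suc n * g a)
    ≡⟨ sum-* (suc i) (n * suc n) g ⟩
  n * suc n * S n i k ∎
  where
    K = k * suc k
    g g′ : ℕ → ℕ
    g  a = coeff i k a * F n (k + a)
    g′ a = coeff i (suc k) a * F n (suc k + a)
    -- the two parts into which k(k+1)·g is completed by the recurrence of F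
    t h : ℕ → ℕ
    t a = suc (k + a) * suc (k + a) * coeff i k a * F n (suc (k + a))
    h a = a * (suc k + k + a) * coeff i k a * F n (k + a)

    -- n(n+1)·g a = t a + k(k+1)·g a + h a, using (k+a)(k+a+1) = k(k+1) + a(2k+1+a).
    this-term : ∀ a → n * suc n * g a ≡ t a + K * g a + h a
    this-term a = begin
      n * suc n * (c * f₀)                              ≡⟨ *-left-comm (n * suc n) c f₀ ⟩
      c * (n * suc n * f₀)                              ≡⟨ cong (c *_) (sym (F-recurrence n (k + a))) ⟩
      c * (suc (k + a) * suc (k + a) * f₁ + (k + a) * suc (k + a) * f₀)
        ≡⟨ split-square k a c f₀ f₁ ⟩
      t a + K * (c * f₀) + h a                          ∎
      where
        c  = coeff i k a
        f₀ = F n (k + a)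
        f₁ = F n (suc (k + a))
        split-square : ∀ k a c f₀ f₁ →
          c * (suc (k + a) * suc (k + a) * f₁ + (k + a) * suc (k + a) * f₀)
            ≡ suc (k + a) * suc (k + a) * c * f₁ + k * suc k * (c * f₀) + a * (suc k + k + a) * c * f₀
        split-square = solve-∀

    next-term : ∀ a → suc k * suc k * g′ a ≡ t a + h (suc a)
    next-term a = begin
      suc k * suc k * (coeff i (suc k) a * f₁)          ≡⟨ sym (*-assoc (suc k * suc k) (coeff i (suc k) a) f₁) ⟩
      suc k * suc k * coeff i (suc k) a * f₁            ≡⟨ cong (_* f₁) (coeff-recurrence i k a) ⟩
      (suc (k + a) * suc (k + a) * coeff i k a + suc a * (suc k + k + suc a) * coeff i k (suc a)) * f₁
        ≡⟨ *-distribʳ-+ f₁ (suc (k + a) * suc (k + a) * coeff i k a) (suc a * (suc k + k + suc a) * coeff i k (suc a)) ⟩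
      t a + suc a * (suc k + k + suc a) * coeff i k (suc a) * f₁
        ≡⟨ cong (λ m → t a + suc a * (suc k + k + suc a) * coeff i k (suc a) * F n m) (sym (+-suc k a)) ⟩
      t a + h (suc a) ∎
      where f₁ = F n (suc (k + a))

    h-last : h (suc i) ≡ 0
    h-last = begin
      suc i * (suc k + k + suc i) * (p * q * (i C suc i)) * F n (k + suc i)
        ≡⟨ cong (λ z → suc i * (suc k + k + suc i) * (p * q * z) * F n (k + suc i)) (k>n⇒nCk≡0 {i} {suc i} ≤-refl) ⟩
      suc i * (suc k + k + suc i) * (p * q * 0) * F n (k + suc i)
        ≡⟨ cong (λ z → suc i * (suc k + k + suc i) * z * F n (k + suc i)) (*-zeroʳ (p * q)) ⟩
      suc i * (suc k + k + suc i) * 0 * F n (k + suc i)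
        ≡⟨ cong (_* F n (k + suc i)) (*-zeroʳ (suc i * (suc k + k + suc i))) ⟩
      0 ∎
      where
        p = (i + k) C i
        q = (k + suc i) C i

-- At k = 0 only the term a = i survives, and it equals F n i.
S-initial : ∀ n i → S n i 0 ≡ F n i * F n 0
S-initial n i = begin
  sumTo i g + coeff i 0 i * F n i ≡⟨ cong (_+ coeff i 0 i * F n i) (sum-vanishing i g below-i) ⟩
  coeff i 0 i * F n i             ≡⟨ cong (λ m → (m C i) * (i C i) * (i C i) * F n i) (+-identityʳ i) ⟩
  (i C i) * (i C i) * (i C i) * F n i ≡⟨ cong (λ z → z * z * z * F n i) (nCn≡1 i) ⟩
  1 * 1 * 1 * F n i               ≡⟨ +-identityʳ (F n i) ⟩
  F n i                           ≡⟨ sym (*-identityʳ (F n i)) ⟩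
  F n i * F n 0                   ∎
  where
    g : ℕ → ℕ
    g a = coeff i 0 a * F n a
    below-i : ∀ a → a < i → g a ≡ 0
    below-i a a<i = begin
      ((i + 0) C i) * (a C i) * (i C a) * F n a ≡⟨ cong (λ z → ((i + 0) C i) * z * (i C a) * F n a) (k>n⇒nCk≡0 a<i) ⟩
      ((i + 0) C i) * 0 * (i C a) * F n a       ≡⟨ cong (λ z → z * (i C a) * F n a) (*-zeroʳ ((i + 0) C i)) ⟩
      0                                         ∎

S-closed-form : ∀ n i k → S n i k ≡ F n i * F n k
S-closed-form n i =
  three-term-unique {n * suc n} (S-recurrence n i) (three-term-scale {n * suc n} (F n i) (F-recurrence n)) (S-initial n i)

diff-nonneg : ∀ {m n} → n ≤ m → + m - + n ≡ + (m ∸ n)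
diff-nonneg {m} {n} n≤m = trans ([+m]-[+n]≡m⊖n m n) (⊖-≥ n≤m)

diff-neg : ∀ {m n} → m < n → + m - + n ≡ -[1+ (n ∸ suc m) ]
diff-neg {m} {suc n} (s≤s m≤n) = begin
  + m - + suc n       ≡⟨ [+m]-[+n]≡m⊖n m (suc n) ⟩
  m ⊖ suc n           ≡⟨ ⊖-< (s≤s m≤n) ⟩
  - (+ (suc n ∸ m))   ≡⟨ cong (λ t → - (+ t)) (+-∸-assoc 1 m≤n) ⟩
  -[1+ (n ∸ m) ]      ∎

multinomial-neg-middle : ∀ m x d z → multinomial m x -[1+ d ] z ≡ 0
multinomial-neg-middle m (+ x)    d z = refl
multinomial-neg-middle m -[1+ x ] d z = refl

multinomial-exact : ∀ j x a y D → x + a + y ≡ j → j ! ≡ D * (x ! * a ! * y !) →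
                    multinomial j (+ x) (+ a) (+ y) ≡ D
multinomial-exact j x a y D sum≡j j!≡ rewrite dec-true (x + a + y ≟ j) sum≡j =
  trans (/-congˡ j!≡) (m*n/n≡m D (x ! * a ! * y !))
  where
    instance
      _ : NonZero (x ! * a ! * y !)
      _ = m*n≢0 (x ! * a !) (y !) {{m*n≢0 (x !) (a !) {{x !≢0}} {{a !≢0}}}} {{y !≢0}}

multinomial-binomial : ∀ j i a → a ≤ i → multinomial j (+ j - + i) (+ a) (+ (i ∸ a)) ≡ (j C i) * (i C a)
multinomial-binomial j i a a≤i with i ≤? j
... | yes i≤j rewrite diff-nonneg i≤j =
  multinomial-exact j (j ∸ i) a (i ∸ a) ((j C i) * (i C a)) parts factorials
  where
    parts : (j ∸ i) + a + (i ∸ a) ≡ j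
    parts = begin
      (j ∸ i) + a + (i ∸ a)   ≡⟨ +-assoc (j ∸ i) a (i ∸ a) ⟩
      (j ∸ i) + (a + (i ∸ a)) ≡⟨ cong (λ z → (j ∸ i) + z) (m+[n∸m]≡n a≤i) ⟩
      (j ∸ i) + i             ≡⟨ m∸n+n≡m i≤j ⟩
      j                       ∎
    regroup : ∀ c c′ x y z → c * (c′ * (y * z) * x) ≡ c * c′ * (x * y * z)
    regroup = solve-∀
    factorials : j ! ≡ (j C i) * (i C a) * ((j ∸ i) ! * a ! * (i ∸ a) !)
    factorials = begin
      j !                                                     ≡⟨ sym (C-factorial i≤j) ⟩
      (j C i) * (i ! * (j ∸ i) !)                             ≡⟨ cong (λ z → (j C i) * (z * (j ∸ i) !)) (sym (C-factorial a≤i)) ⟩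
      (j C i) * ((i C a) * (a ! * (i ∸ a) !) * (j ∸ i) !)     ≡⟨ regroup (j C i) (i C a) ((j ∸ i) !) (a !) ((i ∸ a) !) ⟩
      (j C i) * (i C a) * ((j ∸ i) ! * a ! * (i ∸ a) !)       ∎
... | no i≰j rewrite diff-neg (≰⇒> i≰j) | k>n⇒nCk≡0 (≰⇒> i≰j) = refl

multinomial-window : ∀ i k a → a ≤ i →
  multinomial (k + a) (+ (k + a) - + i) (+ (k + a) - + k) (+ (i + k) - + (k + a)) ≡ ((k + a) C i) * (i C a)
multinomial-window i k a a≤i = begin
  multinomial (k + a) (+ (k + a) - + i) (+ (k + a) - + k) (+ (i + k) - + (k + a))
    ≡⟨ cong₂ (multinomial (k + a) (+ (k + a) - + i)) middle last ⟩
  multinomial (k + a) (+ (k + a) - + i) (+ a) (+ (i ∸ a))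
    ≡⟨ multinomial-binomial (k + a) i a a≤i ⟩
  ((k + a) C i) * (i C a) ∎
  where
    middle : + (k + a) - + k ≡ + a
    middle = trans (diff-nonneg (m≤m+n k a)) (cong +_ (m+n∸m≡n k a))
    last : + (i + k) - + (k + a) ≡ + (i ∸ a)
    last = begin
      + (i + k) - + (k + a)   ≡⟨ cong (λ m → + m - + (k + a)) (+-comm i k) ⟩
      + (k + i) - + (k + a)   ≡⟨ diff-nonneg (+-monoʳ-≤ k a≤i) ⟩
      + ((k + i) ∸ (k + a))   ≡⟨ cong +_ ([m+n]∸[m+o]≡n∸o k i a) ⟩
      + (i ∸ a)               ∎

mainTheorem3 : (n i k : ℕ) →
    (n C i) * ((n + i) C i) * (n C k) * ((n + k) C k)
      ≡ sumTo (suc (i + k)) (λ j →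
          ((i + k) C i) * multinomial j (+ j - + i) (+ j - + k) (+ (i + k) - + j)
            * (n C j) * ((n + j) C j))
mainTheorem3 n i k = begin
  F n i * (n C k) * ((n + k) C k)  ≡⟨ *-assoc (F n i) (n C k) ((n + k) C k) ⟩
  F n i * F n k                    ≡⟨ sym (S-closed-form n i k) ⟩
  S n i k                          ≡⟨ sum-cong (suc i) (λ a a<1+i → sym (inside a a<1+i)) ⟩
  sumTo (suc i) (λ a → G (k + a))  ≡⟨ sym (sum-drop-prefix k (suc i) G below) ⟩
  sumTo (k + suc i) G              ≡⟨ cong (λ m → sumTo m G) (trans (+-suc k i) (cong suc (+-comm k i))) ⟩
  sumTo (suc (i + k)) G            ∎
  where
    G : ℕ → ℕ
    G j = ((i + k) C i) * multinomial j (+ j - + i) (+ j - + k) (+ (i + k) - + j) * (n C j) * ((n + j) C j)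
    -- for j < k the middle lower entry j − k is negative
    below : ∀ j → j < k → G j ≡ 0
    below j j<k rewrite diff-neg j<k
                      | multinomial-neg-middle j (+ j - + i) (k ∸ suc j) (+ (i + k) - + j)
                      | *-zeroʳ ((i + k) C i) = refl
    inside : ∀ a → a < suc i → G (k + a) ≡ coeff i k a * F n (k + a)
    inside a (s≤s a≤i) rewrite multinomial-window i k a a≤i =
      regroup ((i + k) C i) ((k + a) C i) (i C a) (n C (k + a)) ((n + (k + a)) C (k + a))
      where
        regroup : ∀ p u r x y → p * (u * r) * x * y ≡ p * u * r * (x * y)
        regroup = solve-∀
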